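{- Let $H$ be a heap data structure with the unified bound. Then, starting from an empty heap and for every sequence of operations, $\texttt{push}$ runs in amortized $O(1)$ time and every operation $x \gets \texttt{pop}()$ runs in amortized $O(1 + \log(1 + t - a(x)))$ time, where $t$ is the number of push operations performed so far.
   Context: A heap maintains a set of comparable items under two operations: $\texttt{push}(x)$ adds a new item $x$ to the set, and $x \gets \texttt{pop}()$ removes the smallest item $x$ currently in the set and returns it. Consider an initially empty heap subjected to an arbitrary sequence of push and pop operations (items may remain at the end). Let $X$ be the set of pushed items. For $x \in X$, $x$ is the $a(x)$-th item to be pushed; if $x$ is popped, it is the $b(x)$-th item popped, otherwise $b(x)=\infty$. A heap has the unified bound if $\texttt{push}$ runs in amortized $O(1)$ time, the very first $\texttt{pop}$ runs in amortized $O(1)$ time, and every subsequent $x \gets \texttt{pop}()$ runs in amortized $O\big(\min_{y \in X:\ b(y) < b(x)} (1 + \log |a(x) - a(y)| + \log (b(x) - b(y)))\big)$ time. Logarithms are base 2. -}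

module Defs where

open import Data.Nat using (ℕ; zero; suc; _+_; _*_; _∸_; _≤_; _⊓_; _<ᵇ_; _≡ᵇ_; ∣_-_∣)
open import Data.Nat.Logarithm using (⌊log₂_⌋)
open import Data.Bool using (Bool; true; false; if_then_else_)
open import Data.List using (List; []; _∷_; _++_; [_]; map; foldr)
open import Data.Bool.ListAction using (any)
open import Data.Nat.ListAction using (sum)
open import Data.Maybe using (Maybe; just; nothing)
import Data.Maybe as Maybe
open import Data.Product using (_×_; _,_; Σ)
open import Relation.Binary.PropositionalEquality using (_≡_)

data Op : Set where
  push : ℕ → Op
  pop  : Op

-- Information recorded for each executed operation.
--   pushE               : a push
--   popE a b t past     : a pop returning x with a = a(x), b = b(x),
--                         t = number of pushes performed so far,
--                         past = list of (a(y), b(y)) for all y popped before x.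
data Ev : Set where
  pushE : Ev
  popE  : (a b t : ℕ) → List (ℕ × ℕ) → Ev

-- Heap state: contents as (key , a(key)), #pushes, #pops,
-- past pops (a(y) , b(y)), and all keys ever pushed.
data St : Set where
  st : List (ℕ × ℕ) → ℕ → ℕ → List (ℕ × ℕ) → List ℕ → St

initSt : St
initSt = st [] 0 0 [] []

popMin : List (ℕ × ℕ) → Maybe ((ℕ × ℕ) × List (ℕ × ℕ))
popMin [] = nothing
popMin (e ∷ es) with popMin es
... | nothing = just (e , [])
... | just ((k , i) , rest) with Data.Product.proj₁ e <ᵇ k
...   | true  = just (e , es)
...   | false = just ((k , i) , e ∷ rest)

-- Returns nothing if the sequence is invalid: a pop on an empty heap,
-- or a push of an item that was already pushed (items are distinct).
exec : St → List Op → Maybe (List Ev)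
exec s [] = just []
exec (st h t p past keys) (push x ∷ os) =
  if any (x ≡ᵇ_) keys then nothing
  else Maybe.map (pushE ∷_) (exec (st ((x , suc t) ∷ h) (suc t) p past (x ∷ keys)) os)
exec (st h t p past keys) (pop ∷ os) with popMin h
... | nothing = nothing
... | just ((x , a) , rest) =
  Maybe.map (popE a (suc p) t past ∷_) (exec (st rest t (suc p) ((a , suc p) ∷ past) keys) os)

-- A heap is abstracted by its actual running time: the cost of performing
-- an operation after a given history (list of earlier operations, in order).
CostModel : Set
CostModel = List Op → Op → ℕ

totalCostFrom : CostModel → List Op → List Op → ℕ
totalCostFrom H hist [] = 0
totalCostFrom H hist (o ∷ os) = H hist o + totalCostFrom H (hist ++ [ o ]) os

totalCost : CostModel → List Op → ℕ
totalCost H ops = totalCostFrom H [] ops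

-- Since every prefix of a
-- valid sequence is valid, this is the usual prefix-sum / potential-function
-- notion of amortized cost.
HasAmortizedBound : CostModel → (Ev → ℕ) → Set
HasAmortizedBound H f =
  Σ ℕ λ C → ∀ (ops : List Op) (evs : List Ev) → exec initSt ops ≡ just evs →
    totalCost H ops ≤ C * sum (map f evs)

unifiedTerm : ℕ → ℕ → ℕ × ℕ → ℕ
unifiedTerm a b (a' , b') = 1 + ⌊log₂ ∣ a - a' ∣ ⌋ + ⌊log₂ (b ∸ b') ⌋

unifiedBound : Ev → ℕ
unifiedBound pushE = 1
unifiedBound (popE a b t []) = 1
unifiedBound (popE a b t (q ∷ qs)) =
  foldr (λ q' r → unifiedTerm a b q' ⊓ r) (unifiedTerm a b q) qs

workingBound : Ev → ℕ
workingBound pushE = 1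
workingBound (popE a b t past) = 1 + ⌊log₂ (1 + t ∸ a) ⌋

HasUnifiedBound : CostModel → Set
HasUnifiedBound H = HasAmortizedBound H unifiedBound

{-# OPTIONS --safe #-}
-- Amortize against the potential ⌊log₂ ∣ a(y) - t ∣⌋, where y is the most recently
-- popped item and t the number of pushes so far.  A push raises it by at most 1.
-- When x is popped right after y we have b(x) - b(y) = 1, so by the triangle
-- inequality through t the unified bound of x is at most
-- 2 + ⌊log₂ ∣ a(x) - t ∣⌋ + ⌊log₂ ∣ a(y) - t ∣⌋: the last term is paid by the old
-- potential, and the new potential ⌊log₂ ∣ a(x) - t ∣⌋ together with the middle
-- term by the working-set bound of x.
module Submission where

open import Defs
open import Data.Nat using (ℕ; suc; _+_; _*_; _∸_; _≤_; _⊓_; _<ᵇ_; _≡ᵇ_; ∣_-_∣; z≤n; s≤s)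
open import Data.Nat.Properties
open import Data.Nat.Logarithm using (⌊log₂_⌋; ⌊log₂⌋-mono-≤; ⌊log₂[2*b]⌋≡1+⌊log₂b⌋)
open import Data.Nat.Solver using (module +-*-Solver)
open import Data.Bool using (true; false)
open import Data.Bool.ListAction using (any)
open import Data.List using (List; []; _∷_; map; foldr)
open import Data.List.Relation.Unary.All as All using (All; []; _∷_)
open import Data.Nat.ListAction using (sum)
open import Data.Maybe using (Maybe; just; nothing)
import Data.Maybe as Maybe
open import Data.Maybe.Relation.Unary.All as MaybeAll using (just; nothing)
open import Data.Product using (_×_; _,_; proj₁; proj₂)
open import Data.Sum using (inj₁; inj₂)
open import Data.Unit using (⊤; tt)
open import Function using (_∘_)
open import Relation.Binary.PropositionalEquality using (_≡_; refl; trans; cong; subst)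

open +-*-Solver using (solve; _:=_; _:+_; _:*_; con)
open ≤-Reasoning

⌊log₂[m+n]⌋≤1+⌊log₂k⌋ : ∀ {m n} k → m ≤ k → n ≤ k → ⌊log₂ (m + n) ⌋ ≤ 1 + ⌊log₂ k ⌋
⌊log₂[m+n]⌋≤1+⌊log₂k⌋ 0 z≤n z≤n = z≤n
⌊log₂[m+n]⌋≤1+⌊log₂k⌋ {m} {n} k@(suc _) m≤k n≤k = begin
  ⌊log₂ (m + n) ⌋     ≤⟨ ⌊log₂⌋-mono-≤ (+-mono-≤ m≤k (m≤n⇒m≤n+o 0 n≤k)) ⟩
  ⌊log₂ (2 * k) ⌋     ≡⟨ ⌊log₂[2*b]⌋≡1+⌊log₂b⌋ k ⟩
  1 + ⌊log₂ k ⌋       ∎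

⌊log₂[m+n]⌋≤1+⌊log₂m⌋+⌊log₂n⌋ : ∀ m n → ⌊log₂ (m + n) ⌋ ≤ 1 + ⌊log₂ m ⌋ + ⌊log₂ n ⌋
⌊log₂[m+n]⌋≤1+⌊log₂m⌋+⌊log₂n⌋ m n with ≤-total m n
... | inj₁ m≤n = ≤-trans (⌊log₂[m+n]⌋≤1+⌊log₂k⌋ n m≤n ≤-refl) (s≤s (m≤n+m _ _))
... | inj₂ n≤m = ≤-trans (⌊log₂[m+n]⌋≤1+⌊log₂k⌋ m ≤-refl n≤m) (s≤s (m≤m+n _ _))

foldr-⊓-≤-init : ∀ {A : Set} (f : A → ℕ) x xs → foldr (λ y r → f y ⊓ r) (f x) xs ≤ f x
foldr-⊓-≤-init f x []       = ≤-refl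
foldr-⊓-≤-init f x (y ∷ xs) = ≤-trans (m⊓n≤n (f y) _) (foldr-⊓-≤-init f x xs)

popMin-All : ∀ {P : ℕ × ℕ → Set} {h} → All P h →
             MaybeAll.All (λ (e , rest) → P e × All P rest) (popMin h)
popMin-All [] = nothing
popMin-All {h = e ∷ es} (pe ∷ pes) with popMin es | popMin-All pes
... | nothing | nothing = just (pe , [])
... | just ((k , _) , _) | just (pk , prest) with proj₁ e <ᵇ k
...   | true  = just (pe , pes)
...   | false = just (pk , pe ∷ prest)

potential : ℕ → List (ℕ × ℕ) → ℕ
potential t []            = 0
potential t ((a , _) ∷ _) = ⌊log₂ ∣ a - t ∣ ⌋

LatestPopIs : ℕ → List (ℕ × ℕ) → Set
LatestPopIs p []            = ⊤
LatestPopIs p ((_ , b) ∷ _) = b ≡ p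

Invariant : St → Set
Invariant (st h t p past _) = All ((_≤ t) ∘ proj₂) h × LatestPopIs p past

Amortized : ℕ → Maybe (List Ev) → Set
Amortized Φ = MaybeAll.All λ evs →
  sum (map unifiedBound evs) ≤ 3 * sum (map workingBound evs) + Φ

potential-telescope : ∀ c {u w U W Φ Φ′} →
                      u + Φ′ ≤ c * w + Φ → U ≤ c * W + Φ′ → u + U ≤ c * (w + W) + Φ
potential-telescope c {u} {w} {U} {W} {Φ} {Φ′} step rest = begin
  u + U                 ≤⟨ +-monoʳ-≤ u rest ⟩
  u + (c * W + Φ′)      ≡⟨ solve 3 (λ u x y → u :+ (x :+ y) := (u :+ y) :+ x) refl u (c * W) Φ′ ⟩
  (u + Φ′) + c * W      ≤⟨ +-monoˡ-≤ (c * W) step ⟩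
  (c * w + Φ) + c * W   ≡⟨ solve 4 (λ c w W Φ → (c :* w :+ Φ) :+ c :* W
                                               := c :* (w :+ W) :+ Φ) refl c w W Φ ⟩
  c * (w + W) + Φ       ∎

Amortized-∷ : ∀ {e Φ Φ′ m} → unifiedBound e + Φ′ ≤ 3 * workingBound e + Φ →
              Amortized Φ′ m → Amortized Φ (Maybe.map (e ∷_) m)
Amortized-∷ step nothing = nothing
Amortized-∷ {e} {m = just evs} step (just rest) =
  just (potential-telescope 3 {w = workingBound e} {W = sum (map workingBound evs)} step rest)

potential-suc : ∀ t past → potential (suc t) past ≤ 1 + potential t past
potential-suc t []            = z≤n
potential-suc t ((a , _) ∷ _) = begin
  ⌊log₂ ∣ a - suc t ∣ ⌋                           ≤⟨ ⌊log₂⌋-mono-≤ (∣-∣-triangle a t (suc t)) ⟩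
  ⌊log₂ (∣ a - t ∣ + ∣ t - suc t ∣) ⌋              ≤⟨ ⌊log₂[m+n]⌋≤1+⌊log₂m⌋+⌊log₂n⌋ ∣ a - t ∣ ∣ t - suc t ∣ ⟩
  1 + ⌊log₂ ∣ a - t ∣ ⌋ + ⌊log₂ ∣ t - suc t ∣ ⌋    ≡⟨ cong (λ d → 1 + ⌊log₂ ∣ a - t ∣ ⌋ + ⌊log₂ d ⌋) ∣t-1+t∣≡1 ⟩
  1 + ⌊log₂ ∣ a - t ∣ ⌋ + 0                       ≡⟨ +-identityʳ _ ⟩
  1 + ⌊log₂ ∣ a - t ∣ ⌋                           ∎
  where
  ∣t-1+t∣≡1 : ∣ t - suc t ∣ ≡ 1
  ∣t-1+t∣≡1 = trans (m≤n⇒∣m-n∣≡n∸m (n≤1+n t)) (m+n∸n≡m 1 t)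

unifiedBound-pop-≤ : ∀ a t {p} past → LatestPopIs p past →
                     unifiedBound (popE a (suc p) t past) ≤ 2 + ⌊log₂ ∣ a - t ∣ ⌋ + potential t past
unifiedBound-pop-≤ a t []                    _    = s≤s z≤n
unifiedBound-pop-≤ a t {p} ((a′ , _) ∷ past) refl = begin
  unifiedBound (popE a (suc p) t ((a′ , p) ∷ past))       ≤⟨ foldr-⊓-≤-init (unifiedTerm a (suc p)) (a′ , p) past ⟩
  1 + ⌊log₂ ∣ a - a′ ∣ ⌋ + ⌊log₂ (suc p ∸ p) ⌋            ≡⟨ cong (λ d → 1 + ⌊log₂ ∣ a - a′ ∣ ⌋ + ⌊log₂ d ⌋) (m+n∸n≡m 1 p) ⟩
  1 + ⌊log₂ ∣ a - a′ ∣ ⌋ + 0                              ≡⟨ +-identityʳ _ ⟩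
  1 + ⌊log₂ ∣ a - a′ ∣ ⌋                                  ≤⟨ s≤s (⌊log₂⌋-mono-≤ (∣-∣-triangle a t a′)) ⟩
  1 + ⌊log₂ (∣ a - t ∣ + ∣ t - a′ ∣) ⌋                    ≤⟨ s≤s (⌊log₂[m+n]⌋≤1+⌊log₂m⌋+⌊log₂n⌋ ∣ a - t ∣ ∣ t - a′ ∣) ⟩
  2 + ⌊log₂ ∣ a - t ∣ ⌋ + ⌊log₂ ∣ t - a′ ∣ ⌋              ≡⟨ cong (λ d → 2 + ⌊log₂ ∣ a - t ∣ ⌋ + ⌊log₂ d ⌋) (∣-∣-comm t a′) ⟩
  2 + ⌊log₂ ∣ a - t ∣ ⌋ + ⌊log₂ ∣ a′ - t ∣ ⌋              ∎

push-amortized : ∀ t past → 1 + potential (suc t) past ≤ 3 * 1 + potential t past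
push-amortized t past = s≤s (≤-trans (potential-suc t past) (n≤1+n _))

pop-amortized : ∀ {a t p} past → a ≤ t → LatestPopIs p past →
                unifiedBound (popE a (suc p) t past) + potential t ((a , suc p) ∷ past)
                  ≤ 3 * workingBound (popE a (suc p) t past) + potential t past
pop-amortized {a} {t} {p} past a≤t latest = begin
  U + L                     ≤⟨ +-mono-≤ (unifiedBound-pop-≤ a t past latest) L≤W ⟩
  (2 + L + Φ) + W           ≤⟨ +-monoˡ-≤ W (+-monoˡ-≤ Φ (+-monoʳ-≤ 2 L≤W)) ⟩
  (2 + W + Φ) + W           ≤⟨ m≤m+n _ (1 + W) ⟩
  (2 + W + Φ) + W + (1 + W) ≡⟨ solve 2 (λ W Φ → (con 2 :+ W :+ Φ) :+ W :+ (con 1 :+ W)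
                                                 := con 3 :* (con 1 :+ W) :+ Φ) refl W Φ ⟩
  3 * (1 + W) + Φ           ∎
  where
  U = unifiedBound (popE a (suc p) t past)
  L = ⌊log₂ ∣ a - t ∣ ⌋
  W = ⌊log₂ (1 + t ∸ a) ⌋
  Φ = potential t past
  L≤W : L ≤ W
  L≤W = ⌊log₂⌋-mono-≤ (≤-trans (≤-reflexive (m≤n⇒∣m-n∣≡n∸m a≤t)) (∸-monoˡ-≤ a (n≤1+n t)))

exec-amortized : ∀ {h t p past keys} os → Invariant (st h t p past keys) →
                 Amortized (potential t past) (exec (st h t p past keys) os)
exec-amortized [] _ = just z≤n
exec-amortized {t = t} {past = past} {keys = keys} (push x ∷ os) (pushed≤t , latest)
  with any (x ≡ᵇ_) keys
... | true  = nothing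
... | false = Amortized-∷ (push-amortized t past)
                (exec-amortized os (≤-refl ∷ All.map m≤n⇒m≤1+n pushed≤t , latest))
exec-amortized {h = h} {past = past} (pop ∷ os) (pushed≤t , latest)
  with popMin h | popMin-All pushed≤t
... | nothing               | nothing              = nothing
... | just ((_ , a) , rest) | just (a≤t , rest≤t) =
  Amortized-∷ (pop-amortized past a≤t latest) (exec-amortized os (rest≤t , refl))

unifiedBound-sum≤3*workingBound-sum : ∀ ops evs → exec initSt ops ≡ just evs →
  sum (map unifiedBound evs) ≤ 3 * sum (map workingBound evs)
unifiedBound-sum≤3*workingBound-sum ops evs eq =
  ≤-trans (MaybeAll.drop-just (subst (Amortized 0) eq (exec-amortized ops ([] , tt))))
          (≤-reflexive (+-identityʳ _))

HasAmortizedBound-mono : ∀ {H f g} c →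
  (∀ ops evs → exec initSt ops ≡ just evs → sum (map f evs) ≤ c * sum (map g evs)) →
  HasAmortizedBound H f → HasAmortizedBound H g
HasAmortizedBound-mono {H} {f} {g} c f≤c*g (C , bound) = C * c , λ ops evs eq → begin
  totalCost H ops             ≤⟨ bound ops evs eq ⟩
  C * sum (map f evs)         ≤⟨ *-monoʳ-≤ C (f≤c*g ops evs eq) ⟩
  C * (c * sum (map g evs))   ≡⟨ *-assoc C c _ ⟨
  C * c * sum (map g evs)     ∎

lemma8 : (H : CostModel) → HasUnifiedBound H → HasAmortizedBound H workingBound
lemma8 H = HasAmortizedBound-mono 3 unifiedBound-sum≤3*workingBound-sum
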